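{- Let $1\leq t\leq k-2$ and $\binom{t+2}{2}(k-t+1)^2+t\leq n$. Then (i) if $1\leq t\leq \frac{k}{2}-\frac{3}{2}$, then $h_2(t+2)<f(n,k,t)$; (ii) if $\frac{k}{2}-\frac{3}{2}<t\leq k-2$, then $h_2(t+2)>f(n,k,t)$.
   Context: For a $(t+2)$-subset $Z\subseteq[n]$, $\mathcal{H}_2(Z)=\{F\in\binom{[n]}{k}: |F\cap Z|\geq t+1\}$ and $h_2(t+2)=|\mathcal{H}_2(Z)|$. Also $f(n,k,t)=(k-t)\binom{n-t-1}{k-t-1}-\binom{k-t}{2}\binom{n-t-2}{k-t-2}$. -}

module Defs where

open import Data.Nat using (ℕ; zero; suc; _+_; _*_; _∸_; _≤?_; _≟_)
open import Data.Nat.Combinatorics using (_C_)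
open import Data.Integer using (ℤ; +_; _-_)
open import Data.Bool using (true; false)
open import Data.Vec using ([]; _∷_)
open import Data.List using (List; [_]; _++_; map; filter; length)
open import Data.Fin.Subset using (Subset; _∩_; ∣_∣)
open import Relation.Nullary.Decidable using (_×-dec_)

allSubsets : (n : ℕ) → List (Subset n)
allSubsets zero = [ [] ]
allSubsets (suc n) = map (false ∷_) (allSubsets n) ++ map (true ∷_) (allSubsets n)

H₂ : (n k t : ℕ) → Subset n → List (Subset n)
H₂ n k t Z = filter (λ F → (∣ F ∣ ≟ k) ×-dec (suc t ≤? ∣ F ∩ Z ∣)) (allSubsets n)

-- h₂(t+2) = |H₂(Z)| for a (t+2)-subset Z.
h₂ : (n k t : ℕ) → Subset n → ℕ
h₂ n k t Z = length (H₂ n k t Z)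

f : (n k t : ℕ) → ℤ
f n k t = + ((k ∸ t) * ((n ∸ t ∸ 1) C (k ∸ t ∸ 1)))
        - + (((k ∸ t) C 2) * ((n ∸ t ∸ 2) C (k ∸ t ∸ 2)))

-- Write q = n - (t+2) for the number of points outside Z and k = t+2+j.  A k-set meets Z in
-- at least t+1 points exactly when it has t+1 points in Z and j+1 outside, or t+2 in Z and
-- j outside, so h₂ = (t+2) C(q,j+1) + C(q,j).  Likewise f = (j+2) C(q+1,j+1) - C(j+2,2) C(q,j).
-- By Pascal's rule both h₂ + C(j+2,2) C(q,j) and (j+2) C(q+1,j+1) contain (j+2) C(q,j), and
-- after cancelling it the two parts become:
--   (i)  j ≥ t+1:  C(j+1,2) C(q,j) < (j-t) C(q,j+1);
--   (ii) j ≤ t:    0 < (t-j) C(q,j+1) + C(j+1,2) C(q,j).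
-- Part (ii) only needs C(q,j), C(q,j+1) > 0, which the size bound on n guarantees.  For
-- part (i), absorption (j+1) C(q,j+1) = (q-j) C(q,j) reduces it to the polynomial inequality
-- j(j+1)² + 2aj < 2aq (a = j-t), which follows from C(t+2,2)(j+3)² ≤ q + 2.
module Submission where

open import Defs
open import Data.Nat using (ℕ; _+_; _*_; _∸_; _^_; _≤_; _<_)
open import Data.Nat.Combinatorics using (_C_)
open import Data.Integer using (+_) renaming (_<_ to _<ℤ_)
open import Data.Fin.Subset using (Subset; ∣_∣)
open import Data.Product using (_×_)
open import Relation.Binary.PropositionalEquality using (_≡_)

open import Data.Nat
open import Data.Nat.Properties
open import Data.Nat.Combinatorics
open import Data.Nat.Tactic.RingSolver using (solve-∀)
open import Data.Integer using (_-_; _⊖_)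
import Data.Integer.Properties as ℤ
open import Data.Bool using (Bool; true; false; _∧_; if_then_else_)
open import Data.Bool.Properties using (∧-zeroʳ; ∧-identityʳ)
open import Data.Vec using ([]; _∷_)
open import Data.List using (List; []; _∷_; _++_; map; filter; length)
open import Data.Fin.Subset using (_∩_; _─_; ∁)
open import Data.Fin.Subset.Properties using (∣p∩q∣≤∣q∣; ∣∁p∣≡n∸∣p∣; ∣p∣≤n)
open import Data.Product using (_,_)
open import Relation.Unary using (Decidable)
open import Relation.Nullary using (does)
open import Relation.Binary.PropositionalEquality
open import Algebra.Properties.CommutativeSemigroup +-commutativeSemigroup
  using () renaming (interchange to +-interchange)

C-pos : ∀ n k → k ≤ n → 0 < n C k
C-pos zero zero _ = s≤s z≤n
C-pos (suc n) zero _ = s≤s z≤n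
C-pos (suc n) (suc k) (s≤s k≤n) =
  subst (0 <_) (nCk+nC[k+1]≡[n+1]C[k+1] n k) (≤-trans (C-pos n k k≤n) (m≤m+n (n C k) (n C suc k)))

absorption : ∀ m j → suc j * (m C suc j) + j * (m C j) ≡ m * (m C j)
absorption zero zero = refl
absorption zero (suc j) = cong₂ _+_ (*-zeroʳ (2 + j)) (*-zeroʳ (suc j))
absorption (suc m) zero = begin
  1 * (suc m C 1) + 0 ≡⟨ +-identityʳ (1 * (suc m C 1)) ⟩
  1 * (suc m C 1)     ≡⟨ *-identityˡ (suc m C 1) ⟩
  suc m C 1           ≡⟨ nC1≡n (suc m) ⟩
  suc m               ≡⟨ sym (*-identityʳ (suc m)) ⟩
  suc m * 1           ∎
  where open ≡-Reasoning
absorption (suc m) (suc i) = begin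
  (2 + i) * (suc m C (2 + i)) + (1 + i) * (suc m C (1 + i))
    ≡⟨ cong₂ (λ x y → (2 + i) * x + (1 + i) * y)
             (sym (nCk+nC[k+1]≡[n+1]C[k+1] m (1 + i))) (sym (nCk+nC[k+1]≡[n+1]C[k+1] m i)) ⟩
  (2 + i) * (b + c) + (1 + i) * (a + b)
    ≡⟨ regroup i a b c ⟩
  ((2 + i) * c + (1 + i) * b) + ((1 + i) * b + i * a) + a + b
    ≡⟨ cong₂ (λ x y → x + y + a + b) (absorption m (suc i)) (absorption m i) ⟩
  m * b + m * a + a + b
    ≡⟨ collect m a b ⟩
  suc m * (a + b)
    ≡⟨ cong (suc m *_) (nCk+nC[k+1]≡[n+1]C[k+1] m i) ⟩
  suc m * (suc m C suc i) ∎
  where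
  open ≡-Reasoning
  a = m C i
  b = m C suc i
  c = m C suc (suc i)
  regroup : ∀ i a b c → (2 + i) * (b + c) + (1 + i) * (a + b)
    ≡ ((2 + i) * c + (1 + i) * b) + ((1 + i) * b + i * a) + a + b
  regroup = solve-∀
  collect : ∀ m a b → m * b + m * a + a + b ≡ suc m * (a + b)
  collect = solve-∀

[1+m]C2 : ∀ m → suc m C 2 ≡ m + m C 2
[1+m]C2 m = trans (sym (nCk+nC[k+1]≡[n+1]C[k+1] m 1)) (cong (_+ m C 2) (nC1≡n m))

2*[1+m]C2 : ∀ m → 2 * (suc m C 2) ≡ suc m * m
2*[1+m]C2 zero = refl
2*[1+m]C2 (suc m) = begin
  2 * ((2 + m) C 2)           ≡⟨ cong (2 *_) ([1+m]C2 (suc m)) ⟩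
  2 * (suc m + suc m C 2)     ≡⟨ *-distribˡ-+ 2 (suc m) (suc m C 2) ⟩
  2 * suc m + 2 * (suc m C 2) ≡⟨ cong (λ x → 2 * suc m + x) (2*[1+m]C2 m) ⟩
  2 * suc m + suc m * m       ≡⟨ step m ⟩
  (2 + m) * suc m             ∎
  where
  open ≡-Reasoning
  step : ∀ m → 2 * suc m + suc m * m ≡ (2 + m) * suc m
  step = solve-∀

-- Squares as products, so that the ring solver can handle them.
x^2≡x*x : ∀ x → x ^ 2 ≡ x * x
x^2≡x*x x = cong (x *_) (*-identityʳ x)

indicator : Bool → ℕ
indicator b = if b then 1 else 0

count : {A : Set} → (A → Bool) → List A → ℕ
count p [] = 0
count p (x ∷ xs) = indicator (p x) + count p xs

length-filter≡count : {A : Set} {P : A → Set} (P? : Decidable P) (xs : List A) →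
  length (filter P? xs) ≡ count (λ x → does (P? x)) xs
length-filter≡count P? [] = refl
length-filter≡count P? (x ∷ xs) with does (P? x)
... | true = cong suc (length-filter≡count P? xs)
... | false = length-filter≡count P? xs

count-++ : {A : Set} (p : A → Bool) (xs ys : List A) →
  count p (xs ++ ys) ≡ count p xs + count p ys
count-++ p [] ys = refl
count-++ p (x ∷ xs) ys =
  trans (cong (λ n → indicator (p x) + n) (count-++ p xs ys)) (sym (+-assoc (indicator (p x)) _ _))

count-map : {A B : Set} (p : B → Bool) (g : A → B) (xs : List A) →
  count p (map g xs) ≡ count (λ x → p (g x)) xs
count-map p g [] = refl
count-map p g (x ∷ xs) = cong (λ n → indicator (p (g x)) + n) (count-map p g xs)

count-none : {A : Set} (p : A → Bool) → (∀ x → p x ≡ false) → (xs : List A) → count p xs ≡ 0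
count-none p none [] = refl
count-none p none (x ∷ xs) rewrite none x = count-none p none xs

count-split : {A : Set} (p p₁ p₂ : A → Bool) →
  (∀ x → indicator (p x) ≡ indicator (p₁ x) + indicator (p₂ x)) →
  (xs : List A) → count p xs ≡ count p₁ xs + count p₂ xs
count-split p p₁ p₂ split [] = refl
count-split p p₁ p₂ split (x ∷ xs) = begin
  indicator (p x) + count p xs
    ≡⟨ cong₂ _+_ (split x) (count-split p p₁ p₂ split xs) ⟩
  (indicator (p₁ x) + indicator (p₂ x)) + (count p₁ xs + count p₂ xs)
    ≡⟨ +-interchange (indicator (p₁ x)) (indicator (p₂ x)) (count p₁ xs) (count p₂ xs) ⟩
  (indicator (p₁ x) + count p₁ xs) + (indicator (p₂ x) + count p₂ xs) ∎
  where open ≡-Reasoning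

count-allSubsets-suc : ∀ n (p : Subset (suc n) → Bool) →
  count p (allSubsets (suc n))
    ≡ count (λ F → p (false ∷ F)) (allSubsets n) + count (λ F → p (true ∷ F)) (allSubsets n)
count-allSubsets-suc n p = begin
  count p (map (false ∷_) S ++ map (true ∷_) S)
    ≡⟨ count-++ p (map (false ∷_) S) (map (true ∷_) S) ⟩
  count p (map (false ∷_) S) + count p (map (true ∷_) S)
    ≡⟨ cong₂ _+_ (count-map p (false ∷_) S) (count-map p (true ∷_) S) ⟩
  count (λ F → p (false ∷ F)) S + count (λ F → p (true ∷ F)) S ∎
  where
  open ≡-Reasoning
  S = allSubsets n

∣F∣≡∣F∩Z∣+∣F─Z∣ : ∀ {n} (F Z : Subset n) → ∣ F ∣ ≡ ∣ F ∩ Z ∣ + ∣ F ─ Z ∣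
∣F∣≡∣F∩Z∣+∣F─Z∣ [] [] = refl
∣F∣≡∣F∩Z∣+∣F─Z∣ (false ∷ F) (true ∷ Z) = ∣F∣≡∣F∩Z∣+∣F─Z∣ F Z
∣F∣≡∣F∩Z∣+∣F─Z∣ (false ∷ F) (false ∷ Z) = ∣F∣≡∣F∩Z∣+∣F─Z∣ F Z
∣F∣≡∣F∩Z∣+∣F─Z∣ (true ∷ F) (true ∷ Z) = cong suc (∣F∣≡∣F∩Z∣+∣F─Z∣ F Z)
∣F∣≡∣F∩Z∣+∣F─Z∣ (true ∷ F) (false ∷ Z) =
  trans (cong suc (∣F∣≡∣F∩Z∣+∣F─Z∣ F Z)) (sym (+-suc ∣ F ∩ Z ∣ ∣ F ─ Z ∣))

∣Z∣+∣∁Z∣≡n : ∀ {n} (Z : Subset n) → ∣ Z ∣ + ∣ ∁ Z ∣ ≡ n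
∣Z∣+∣∁Z∣≡n Z = trans (cong (λ m → ∣ Z ∣ + m) (∣∁p∣≡n∸∣p∣ Z)) (m+[n∸m]≡n (∣p∣≤n Z))

hasProfile : ∀ {n} → Subset n → ℕ → ℕ → Subset n → Bool
hasProfile Z a b F = (∣ F ─ Z ∣ ≡ᵇ a) ∧ (∣ F ∩ Z ∣ ≡ᵇ b)

-- The subsets of profile (a , b) are chosen independently outside and inside Z.
count-profile : ∀ n (Z : Subset n) a b →
  count (hasProfile Z a b) (allSubsets n) ≡ (∣ ∁ Z ∣ C a) * (∣ Z ∣ C b)
count-profile zero [] zero zero = refl
count-profile zero [] zero (suc b) = refl
count-profile zero [] (suc a) b = refl
count-profile (suc n) (z ∷ Z) a b =
  trans (count-allSubsets-suc n (hasProfile (z ∷ Z) a b)) (split z a b)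
  where
  open ≡-Reasoning
  S = allSubsets n
  split : ∀ z a b →
    count (λ F → hasProfile (z ∷ Z) a b (false ∷ F)) S + count (λ F → hasProfile (z ∷ Z) a b (true ∷ F)) S
      ≡ (∣ ∁ (z ∷ Z) ∣ C a) * (∣ z ∷ Z ∣ C b)
  split false zero b = begin
    count (hasProfile Z 0 b) S + count (λ _ → false) S
      ≡⟨ cong₂ _+_ (count-profile n Z 0 b) (count-none _ (λ _ → refl) S) ⟩
    (∣ ∁ Z ∣ C 0) * (∣ Z ∣ C b) + 0 ≡⟨ +-identityʳ ((∣ ∁ Z ∣ C 0) * (∣ Z ∣ C b)) ⟩
    (∣ ∁ Z ∣ C 0) * (∣ Z ∣ C b) ∎
  split false (suc a) b = begin
    count (hasProfile Z (suc a) b) S + count (hasProfile Z a b) S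
      ≡⟨ cong₂ _+_ (count-profile n Z (suc a) b) (count-profile n Z a b) ⟩
    (∣ ∁ Z ∣ C suc a) * X + (∣ ∁ Z ∣ C a) * X ≡⟨ sym (*-distribʳ-+ X (∣ ∁ Z ∣ C suc a) (∣ ∁ Z ∣ C a)) ⟩
    (∣ ∁ Z ∣ C suc a + ∣ ∁ Z ∣ C a) * X
      ≡⟨ cong (_* X) (trans (+-comm (∣ ∁ Z ∣ C suc a) (∣ ∁ Z ∣ C a)) (nCk+nC[k+1]≡[n+1]C[k+1] ∣ ∁ Z ∣ a)) ⟩
    (suc ∣ ∁ Z ∣ C suc a) * X ∎
    where X = ∣ Z ∣ C b
  split true a zero = begin
    count (hasProfile Z a 0) S + count (λ F → (∣ F ─ Z ∣ ≡ᵇ a) ∧ false) S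
      ≡⟨ cong₂ _+_ (count-profile n Z a 0) (count-none _ (λ F → ∧-zeroʳ (∣ F ─ Z ∣ ≡ᵇ a)) S) ⟩
    (∣ ∁ Z ∣ C a) * 1 + 0 ≡⟨ +-identityʳ ((∣ ∁ Z ∣ C a) * 1) ⟩
    (∣ ∁ Z ∣ C a) * 1 ∎
  split true a (suc b) = begin
    count (hasProfile Z a (suc b)) S + count (hasProfile Z a b) S
      ≡⟨ cong₂ _+_ (count-profile n Z a (suc b)) (count-profile n Z a b) ⟩
    X * (∣ Z ∣ C suc b) + X * (∣ Z ∣ C b) ≡⟨ sym (*-distribˡ-+ X (∣ Z ∣ C suc b) (∣ Z ∣ C b)) ⟩
    X * (∣ Z ∣ C suc b + ∣ Z ∣ C b)
      ≡⟨ cong (X *_) (trans (+-comm (∣ Z ∣ C suc b) (∣ Z ∣ C b)) (nCk+nC[k+1]≡[n+1]C[k+1] ∣ Z ∣ b)) ⟩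
    X * (suc ∣ Z ∣ C suc b) ∎
    where X = ∣ ∁ Z ∣ C a

-- The closed forms of both sides, with q = n - (t+2) and k = t+2+j:
-- h₂ = (t+2) C(q, j+1) + C(q, j) and f = f₊ - f₋ below.
h₂-closed : ℕ → ℕ → ℕ → ℕ
h₂-closed t j q = (2 + t) * (q C suc j) + q C j

f₊ : ℕ → ℕ → ℕ
f₊ j q = (2 + j) * (suc q C suc j)

f₋ : ℕ → ℕ → ℕ
f₋ j q = ((2 + j) C 2) * (q C j)

-- A set of size 2+t+j meets the (2+t)-set Z in at least t+1 points exactly when
-- its profile is (j+1 , t+1) or (j , t+2); here i = |F ∩ Z| and o = |F ─ Z|.
H₂-test-split : ∀ t j i o → i ≤ 2 + t →
  indicator ((i + o ≡ᵇ 2 + t + j) ∧ (suc t ≤ᵇ i))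
    ≡ indicator ((o ≡ᵇ suc j) ∧ (i ≡ᵇ suc t)) + indicator ((o ≡ᵇ j) ∧ (i ≡ᵇ 2 + t))
H₂-test-split zero j zero o _
  rewrite ∧-zeroʳ (o ≡ᵇ 2 + j) | ∧-zeroʳ (o ≡ᵇ suc j) | ∧-zeroʳ (o ≡ᵇ j) = refl
H₂-test-split zero j 1 o _
  rewrite ∧-identityʳ (o ≡ᵇ suc j) | ∧-zeroʳ (o ≡ᵇ j) = sym (+-identityʳ _)
H₂-test-split zero j 2 o _
  rewrite ∧-identityʳ (o ≡ᵇ j) | ∧-zeroʳ (o ≡ᵇ suc j) = refl
H₂-test-split zero j (suc (suc (suc i))) o (s≤s (s≤s ()))
H₂-test-split (suc t) j zero o _
  rewrite ∧-zeroʳ (o ≡ᵇ 3 + t + j) | ∧-zeroʳ (o ≡ᵇ suc j) | ∧-zeroʳ (o ≡ᵇ j) = refl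
H₂-test-split (suc t) j (suc i) o (s≤s i≤2+t) = H₂-test-split t j i o i≤2+t

h₂-formula : ∀ {n} t j (Z : Subset n) → ∣ Z ∣ ≡ 2 + t →
  h₂ n (2 + t + j) t Z ≡ h₂-closed t j ∣ ∁ Z ∣
h₂-formula {n} t j Z ∣Z∣≡2+t = begin
  h₂ n k t Z
    ≡⟨ length-filter≡count _ S ⟩
  count (λ F → (∣ F ∣ ≡ᵇ k) ∧ (suc t ≤ᵇ ∣ F ∩ Z ∣)) S
    ≡⟨ count-split _ (hasProfile Z (suc j) (suc t)) (hasProfile Z j (2 + t)) test-split S ⟩
  count (hasProfile Z (suc j) (suc t)) S + count (hasProfile Z j (2 + t)) S
    ≡⟨ cong₂ _+_ (count-profile n Z (suc j) (suc t)) (count-profile n Z j (2 + t)) ⟩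
  (q C suc j) * (∣ Z ∣ C suc t) + (q C j) * (∣ Z ∣ C (2 + t))
    ≡⟨ cong (λ m → (q C suc j) * (m C suc t) + (q C j) * (m C (2 + t))) ∣Z∣≡2+t ⟩
  (q C suc j) * ((2 + t) C suc t) + (q C j) * ((2 + t) C (2 + t))
    ≡⟨ cong₂ (λ x y → (q C suc j) * x + (q C j) * y) ([1+m]C[m]≡1+m (suc t)) (nCn≡1 (2 + t)) ⟩
  (q C suc j) * (2 + t) + (q C j) * 1
    ≡⟨ cong₂ _+_ (*-comm (q C suc j) (2 + t)) (*-identityʳ (q C j)) ⟩
  (2 + t) * (q C suc j) + q C j ∎
  where
  open ≡-Reasoning
  k = 2 + t + j
  q = ∣ ∁ Z ∣
  S = allSubsets n
  [1+m]C[m]≡1+m : ∀ m → suc m C m ≡ suc m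
  [1+m]C[m]≡1+m m = trans (nCk≡nC[n∸k] (n≤1+n m))
                          (trans (cong (suc m C_) (m+n∸n≡m 1 m)) (nC1≡n (suc m)))
  test-split : ∀ F → indicator ((∣ F ∣ ≡ᵇ k) ∧ (suc t ≤ᵇ ∣ F ∩ Z ∣))
    ≡ indicator (hasProfile Z (suc j) (suc t) F) + indicator (hasProfile Z j (2 + t) F)
  test-split F = trans
    (cong (λ m → indicator ((m ≡ᵇ k) ∧ (suc t ≤ᵇ ∣ F ∩ Z ∣))) (∣F∣≡∣F∩Z∣+∣F─Z∣ F Z))
    (H₂-test-split t j ∣ F ∩ Z ∣ ∣ F ─ Z ∣ (subst (∣ F ∩ Z ∣ ≤_) ∣Z∣≡2+t (∣p∩q∣≤∣q∣ F Z)))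

[2+t+x]∸t≡2+x : ∀ t x → 2 + t + x ∸ t ≡ 2 + x
[2+t+x]∸t≡2+x zero x = refl
[2+t+x]∸t≡2+x (suc t) x = [2+t+x]∸t≡2+x t x

f-formula : ∀ n t j q → n ≡ 2 + t + q → f n (2 + t + j) t ≡ + f₊ j q - + f₋ j q
f-formula .(2 + t + q) t j q refl rewrite [2+t+x]∸t≡2+x t j | [2+t+x]∸t≡2+x t q = refl

q-large : ∀ T j q → 1 ≤ T → T * (2 + j + 1) ^ 2 ≤ 2 + q → suc j ≤ q
q-large T@(suc _) j q _ bound = subst (_≤ q) (+-comm j 1) (+-cancelˡ-≤ 2 (j + 1) q (begin
  2 + j + 1            ≤⟨ m≤m*n (2 + j + 1) (2 + j + 1) ⟩
  (2 + j + 1) * (2 + j + 1) ≡⟨ sym (x^2≡x*x (2 + j + 1)) ⟩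
  (2 + j + 1) ^ 2      ≤⟨ m≤n*m ((2 + j + 1) ^ 2) T ⟩
  T * (2 + j + 1) ^ 2  ≤⟨ bound ⟩
  2 + q                ∎))
  where open ≤-Reasoning

cubic-gap : ∀ j → 1 ≤ j → j * ((1 + j) * (1 + j)) + 2 * j * j + 4 * j < j * (2 + j + 1) ^ 2
cubic-gap j@(suc i) _ = subst (lower <_) (sym (trans (cong (j *_) (x^2≡x*x (2 + j + 1))) (expand i)))
  (m<m+n lower (s≤s z≤n))
  where
  lower = j * ((1 + j) * (1 + j)) + 2 * j * j + 4 * j
  expand : ∀ i → suc i * ((2 + suc i + 1) * (2 + suc i + 1))
    ≡ suc i * ((1 + suc i) * (1 + suc i)) + 2 * suc i * suc i + 4 * suc i + suc (2 * i * i + 8 * i + 5)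
  expand = solve-∀

cubic-bound : ∀ a j T q → 1 ≤ j → a ≤ j → j ≤ 2 * a * T → T * (2 + j + 1) ^ 2 ≤ 2 + q →
  j * ((1 + j) * (1 + j)) + 2 * a * j < 2 * a * q
cubic-bound a j T q 1≤j a≤j j≤2aT bound = +-cancelʳ-< (4 * a) _ _ (begin-strict
  j * ((1 + j) * (1 + j)) + 2 * a * j + 4 * a
    ≤⟨ +-mono-≤ (+-monoʳ-≤ (j * ((1 + j) * (1 + j))) (*-monoˡ-≤ j (*-monoʳ-≤ 2 a≤j)))
                (*-monoʳ-≤ 4 a≤j) ⟩
  j * ((1 + j) * (1 + j)) + 2 * j * j + 4 * j
    <⟨ cubic-gap j 1≤j ⟩
  j * (2 + j + 1) ^ 2
    ≤⟨ *-monoˡ-≤ ((2 + j + 1) ^ 2) j≤2aT ⟩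
  2 * a * T * (2 + j + 1) ^ 2
    ≡⟨ *-assoc (2 * a) T ((2 + j + 1) ^ 2) ⟩
  2 * a * (T * (2 + j + 1) ^ 2)
    ≤⟨ *-monoʳ-≤ (2 * a) bound ⟩
  2 * a * (2 + q)
    ≡⟨ expand a q ⟩
  2 * a * q + 4 * a ∎)
  where
  open ≤-Reasoning
  expand : ∀ a q → 2 * a * (2 + q) ≡ 2 * a * q + 4 * a
  expand = solve-∀

-- Part (i) in binomial form: C(j+1,2) C(q,j) < a C(q,j+1). Multiplying by 2(j+1) and
-- using absorption, (j+1) C(q,j+1) = q C(q,j) - j C(q,j), this is the cubic bound times C(q,j).
pairs-below : ∀ a j q → 0 < q C j →
  j * ((1 + j) * (1 + j)) + 2 * a * j < 2 * a * q →
  (suc j C 2) * (q C j) < a * (q C suc j)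
pairs-below a j q c>0 cubic = *-cancelˡ-< (2 * suc j) _ _ (+-cancelʳ-< (2 * a * j * c) _ _ (begin-strict
  2 * suc j * (p * c) + 2 * a * j * c
    ≡⟨ pull-2 j p c a ⟩
  suc j * (2 * p) * c + 2 * a * j * c
    ≡⟨ cong (λ x → suc j * x * c + 2 * a * j * c) (2*[1+m]C2 j) ⟩
  suc j * (suc j * j) * c + 2 * a * j * c
    ≡⟨ factor-c j c a ⟩
  (j * ((1 + j) * (1 + j)) + 2 * a * j) * c
    <⟨ *-monoˡ-< c {{>-nonZero c>0}} cubic ⟩
  2 * a * q * c
    ≡⟨ *-assoc (2 * a) q c ⟩
  2 * a * (q * c)
    ≡⟨ cong (2 * a *_) (sym (absorption q j)) ⟩
  2 * a * (suc j * A + j * c)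
    ≡⟨ redistribute j A c a ⟩
  2 * suc j * (a * A) + 2 * a * j * c ∎))
  where
  open ≤-Reasoning
  A = q C suc j
  c = q C j
  p = suc j C 2
  pull-2 : ∀ j p c a → 2 * suc j * (p * c) + 2 * a * j * c ≡ suc j * (2 * p) * c + 2 * a * j * c
  pull-2 = solve-∀
  factor-c : ∀ j c a → suc j * (suc j * j) * c + 2 * a * j * c ≡ (j * ((1 + j) * (1 + j)) + 2 * a * j) * c
  factor-c = solve-∀
  redistribute : ∀ j A c a → 2 * a * (suc j * A + j * c) ≡ 2 * suc j * (a * A) + 2 * a * j * c
  redistribute = solve-∀

excess-positive : ∀ e j A c → 1 ≤ e + j → 0 < A → 0 < c → 0 < e * A + (suc j C 2) * c
excess-positive (suc e) j A c _ A>0 _ =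
  ≤-trans (*-mono-< {0} {suc e} (s≤s z≤n) A>0) (m≤m+n (suc e * A) ((suc j C 2) * c))
excess-positive zero (suc j) A c _ _ c>0 = *-mono-< (C-pos (2 + j) 2 (s≤s (s≤s z≤n))) c>0

-- Pascal's rule makes (j+2) C(q,j) a common summand of h₂ + f₋ and f₊; what remains is to
-- compare (t+2) C(q,j+1) + C(j+1,2) C(q,j) with (j+2) C(q,j+1).
h₂+f₋-split : ∀ t j q → h₂-closed t j q + f₋ j q
  ≡ ((2 + t) * (q C suc j) + (suc j C 2) * (q C j)) + (2 + j) * (q C j)
h₂+f₋-split t j q =
  trans (cong (λ x → (2 + t) * A + c + x * c) ([1+m]C2 (suc j))) (regroup t j A c (suc j C 2))
  where
  A = q C suc j
  c = q C j
  regroup : ∀ t j A c p → (2 + t) * A + c + (suc j + p) * c ≡ ((2 + t) * A + p * c) + (2 + j) * c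
  regroup = solve-∀

f₊-split : ∀ j q → f₊ j q ≡ (2 + j) * (q C suc j) + (2 + j) * (q C j)
f₊-split j q = trans (cong ((2 + j) *_) (sym (nCk+nC[k+1]≡[n+1]C[k+1] q j)))
  (trans (*-distribˡ-+ (2 + j) (q C j) (q C suc j)) (+-comm ((2 + j) * (q C j)) ((2 + j) * (q C suc j))))

t+a≤2aT : ∀ t a → 1 ≤ a → t + a ≤ 2 * a * ((2 + t) C 2)
t+a≤2aT t a@(suc b) _ = begin
  t + a
    ≤⟨ m≤m+n (t + a) (b * t * t + 3 * b * t + b + t * t + 2 * t + 1) ⟩
  t + a + (b * t * t + 3 * b * t + b + t * t + 2 * t + 1)
    ≡⟨ expand t b ⟩
  a * ((2 + t) * (1 + t))
    ≡⟨ cong (a *_) (sym (2*[1+m]C2 (suc t))) ⟩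
  a * (2 * T)
    ≡⟨ trans (sym (*-assoc a 2 T)) (cong (_* T) (*-comm a 2)) ⟩
  2 * a * T ∎
  where
  open ≤-Reasoning
  T = (2 + t) C 2
  expand : ∀ t b → t + suc b + (b * t * t + 3 * b * t + b + t * t + 2 * t + 1) ≡ suc b * ((2 + t) * (1 + t))
  expand = solve-∀

part-i : ∀ t j q → 1 ≤ t → suc t ≤ j → ((2 + t) C 2) * (2 + j + 1) ^ 2 ≤ 2 + q →
  h₂-closed t j q + f₋ j q < f₊ j q
part-i t j q 1≤t t<j bound = begin-strict
  h₂-closed t j q + f₋ j q
    ≡⟨ h₂+f₋-split t j q ⟩
  ((2 + t) * A + (suc j C 2) * c) + (2 + j) * c
    <⟨ +-monoˡ-< ((2 + j) * c) (+-monoʳ-< ((2 + t) * A) pairs<aA) ⟩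
  ((2 + t) * A + a * A) + (2 + j) * c
    ≡⟨ cong (_+ (2 + j) * c) (trans (sym (*-distribʳ-+ A (2 + t) a)) (cong (λ x → (2 + x) * A) t+a≡j)) ⟩
  (2 + j) * A + (2 + j) * c
    ≡⟨ sym (f₊-split j q) ⟩
  f₊ j q ∎
  where
  open ≤-Reasoning
  T = (2 + t) C 2
  A = q C suc j
  c = q C j
  a = j ∸ t
  t+a≡j : t + a ≡ j
  t+a≡j = m+[n∸m]≡n (≤-trans (n≤1+n t) t<j)
  c>0 : 0 < c
  c>0 = C-pos q j (≤-trans (n≤1+n j) (q-large T j q (C-pos (2 + t) 2 (s≤s (s≤s z≤n))) bound))
  j≤2aT : j ≤ 2 * a * T
  j≤2aT = subst (_≤ 2 * a * T) t+a≡j (t+a≤2aT t a (m<n⇒0<n∸m t<j))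
  pairs<aA : (suc j C 2) * c < a * A
  pairs<aA = pairs-below a j q c>0
    (cubic-bound a j T q (≤-trans (s≤s z≤n) t<j) (m∸n≤m j t) j≤2aT bound)

part-ii : ∀ t j q → 1 ≤ t → j ≤ t → ((2 + t) C 2) * (2 + j + 1) ^ 2 ≤ 2 + q →
  f₊ j q < h₂-closed t j q + f₋ j q
part-ii t j q 1≤t j≤t bound = begin-strict
  f₊ j q
    ≡⟨ f₊-split j q ⟩
  (2 + j) * A + (2 + j) * c
    <⟨ +-monoˡ-< ((2 + j) * c) (m<m+n ((2 + j) * A) excess) ⟩
  (2 + j) * A + (e * A + p * c) + (2 + j) * c
    ≡⟨ cong (_+ (2 + j) * c) regroup ⟩
  ((2 + t) * A + p * c) + (2 + j) * c
    ≡⟨ sym (h₂+f₋-split t j q) ⟩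
  h₂-closed t j q + f₋ j q ∎
  where
  open ≤-Reasoning
  A = q C suc j
  c = q C j
  p = suc j C 2
  e = t ∸ j
  j+e≡t : j + e ≡ t
  j+e≡t = m+[n∸m]≡n j≤t
  regroup : (2 + j) * A + (e * A + p * c) ≡ (2 + t) * A + p * c
  regroup = trans (sym (+-assoc ((2 + j) * A) (e * A) (p * c)))
    (cong (_+ p * c) (trans (sym (*-distribʳ-+ A (2 + j) e)) (cong (λ x → (2 + x) * A) j+e≡t)))
  j<q : suc j ≤ q
  j<q = q-large ((2 + t) C 2) j q (C-pos (2 + t) 2 (s≤s (s≤s z≤n))) bound
  excess : 0 < e * A + p * c
  excess = excess-positive e j A c (subst (1 ≤_) (trans (sym j+e≡t) (+-comm j e)) 1≤t)
    (C-pos q (suc j) j<q) (C-pos q j (≤-trans (n≤1+n j) j<q))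

size-bound : ∀ n t j q → n ≡ 2 + t + q →
  ((t + 2) C 2) * ((2 + t + j ∸ t + 1) ^ 2) + t ≤ n →
  ((2 + t) C 2) * (2 + j + 1) ^ 2 ≤ 2 + q
size-bound .(2 + t + q) t j q refl bound rewrite [2+t+x]∸t≡2+x t j | +-comm t 2 =
  +-cancelʳ-≤ t (((2 + t) C 2) * (2 + j + 1) ^ 2) (2 + q)
    (subst (((2 + t) C 2) * (2 + j + 1) ^ 2 + t ≤_) (cong (λ m → 2 + m) (+-comm t q)) bound)

-- 2t+3 = (t+2) + (t+1): the threshold k = 2t+3 corresponds to j = t+1.
2t+3≡2+t+[1+t] : ∀ t → 2 * t + 3 ≡ 2 + t + suc t
2t+3≡2+t+[1+t] = solve-∀

threshold-i : ∀ t j → 2 * t + 3 ≤ 2 + t + j → suc t ≤ j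
threshold-i t j le = +-cancelˡ-≤ (2 + t) (suc t) j (subst (_≤ 2 + t + j) (2t+3≡2+t+[1+t] t) le)

threshold-ii : ∀ t j → 2 + t + j < 2 * t + 3 → j ≤ t
threshold-ii t j lt = s≤s⁻¹ (+-cancelˡ-< (2 + t) j (suc t) (subst (2 + t + j <_) (2t+3≡2+t+[1+t] t) lt))

[h+Y]⊖Y≡h : ∀ h Y → (h + Y) ⊖ Y ≡ + h
[h+Y]⊖Y≡h h Y = trans (ℤ.≤-⊖ (m≤n+m Y h)) (cong +_ (m+n∸n≡m h Y))

below-difference : ∀ h X Y → h + Y < X → + h <ℤ + X - + Y
below-difference h X Y h+Y<X =
  subst₂ _<ℤ_ ([h+Y]⊖Y≡h h Y) (sym (ℤ.[+m]-[+n]≡m⊖n X Y)) (ℤ.⊖-monoˡ-< Y h+Y<X)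

above-difference : ∀ h X Y → X < h + Y → + X - + Y <ℤ + h
above-difference h X Y X<h+Y =
  subst₂ _<ℤ_ (sym (ℤ.[+m]-[+n]≡m⊖n X Y)) ([h+Y]⊖Y≡h h Y) (ℤ.⊖-monoˡ-< Y X<h+Y)

lemma2p8 : (n k t : ℕ) → 1 ≤ t → t + 2 ≤ k →
    ((t + 2) C 2) * ((k ∸ t + 1) ^ 2) + t ≤ n →
    (Z : Subset n) → ∣ Z ∣ ≡ t + 2 →
    ((2 * t + 3 ≤ k → + h₂ n k t Z <ℤ f n k t)
     × (k < 2 * t + 3 → f n k t <ℤ + h₂ n k t Z))
lemma2p8 n k t 1≤t t+2≤k bound Z ∣Z∣≡t+2
  with j , refl ← m≤n⇒∃[o]m+o≡n (subst (_≤ k) (+-comm t 2) t+2≤k) =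
    (λ k≥2t+3 → subst₂ _<ℤ_ (cong +_ (sym h₂≡)) (sym f≡)
      (below-difference (h₂-closed t j q) (f₊ j q) (f₋ j q) (part-i t j q 1≤t (threshold-i t j k≥2t+3) bound′)))
  , (λ k<2t+3 → subst₂ _<ℤ_ (sym f≡) (cong +_ (sym h₂≡))
      (above-difference (h₂-closed t j q) (f₊ j q) (f₋ j q) (part-ii t j q 1≤t (threshold-ii t j k<2t+3) bound′)))
  where
  q = ∣ ∁ Z ∣
  n≡2+t+q : n ≡ 2 + t + q
  n≡2+t+q = sym (trans (cong (_+ q) (sym (trans ∣Z∣≡t+2 (+-comm t 2)))) (∣Z∣+∣∁Z∣≡n Z))
  h₂≡ : h₂ n k t Z ≡ h₂-closed t j q
  h₂≡ = h₂-formula t j Z (trans ∣Z∣≡t+2 (+-comm t 2))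
  f≡ : f n k t ≡ + f₊ j q - + f₋ j q
  f≡ = f-formula n t j q n≡2+t+q
  bound′ : ((2 + t) C 2) * (2 + j + 1) ^ 2 ≤ 2 + q
  bound′ = size-bound n t j q n≡2+t+q bound
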